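{- Let $P$ be the infinite matrix indexed by the non-negative integers with $P(r+1,r)=1$, $P(r,r)=r-1$, $P(r,r+1)=-r-1$ for $r\geq0$, and $P(r,s)=0$ for $|r-s|>1$. Partition the non-negative integers into the intervals $I_0=\{0,\dots,7\}$ and $I_k=\{8+24(k-1),\dots,7+24k\}$ for $k\geq1$. Then for $r\in I_a$, $s\in I_b$, the entry $E(r,s)$ of $E=P^{48}-I$ satisfies $\nu_2(E(r,s))\geq M(a,b)$, where: $M(0,0)=3$, $M(0,1)=7$, $M(0,2)=M(0,3)=11$, $M(0,b)=\infty$ for $b\geq4$; $M(1,0)=1$, $M(2,0)=M(3,0)=0$, $M(a,0)=\infty$ for $a\geq4$; and for $a,b\geq1$: $M(a,b)=1$ if $0\leq b-a\leq 3$, $M(a,b)=0$ if $1\leq a-b\leq3$, and $M(a,b)=\infty$ if $|a-b|\geq4$.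
   Context: $\nu_2$ denotes the $2$-adic valuation, with $\nu_2(0)=\infty$; a lower bound $\infty$ means the entry is $0$. $I$ is the identity matrix. -}

module Defs where

open import Data.Nat as ℕ using (ℕ; zero; suc; _≤_; _<_; _∸_; _^_; _≡ᵇ_; _≤ᵇ_)
open import Data.Integer as ℤ using (ℤ; +_; 0ℤ; 1ℤ; _-_; -_)
open import Data.Integer.Divisibility using (_∣_)
open import Data.Bool using (if_then_else_)
open import Data.Maybe using (Maybe; just; nothing)
open import Data.Product using (_×_)
open import Relation.Binary.PropositionalEquality using (_≡_)

sumTo : ℕ → (ℕ → ℤ) → ℤ
sumTo zero    f = 0ℤ
sumTo (suc n) f = sumTo n f ℤ.+ f n

Mat : Set
Mat = ℕ → ℕ → ℤ

P : Mat
P r s =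
  if r ≡ᵇ s then (+ r) - 1ℤ
  else if s ≡ᵇ suc r then (- (+ r)) - 1ℤ
  else if r ≡ᵇ suc s then 1ℤ
  else 0ℤ

I : Mat
I r s = if r ≡ᵇ s then 1ℤ else 0ℤ

-- Powers P^n.  (P^(n+1))(r,s) = Σ_t P^n(r,t) P(t,s); since P(t,s) = 0 for t > s+1,
-- the sum over all t ∈ ℕ equals the finite sum over t < s+2.
Ppow : ℕ → Mat
Ppow zero    = I
Ppow (suc n) r s = sumTo (suc (suc s)) (λ t → Ppow n r t ℤ.* P t s)

E : Mat
E r s = Ppow 48 r s - I r s

InInterval : ℕ → ℕ → Set
InInterval zero    r = r < 8
InInterval (suc k) r = (8 ℕ.+ 24 ℕ.* k ≤ r) × (r < 8 ℕ.+ 24 ℕ.* suc k)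

ℕ∞ : Set
ℕ∞ = Maybe ℕ

∞ : ℕ∞
∞ = nothing

ν₂≥ : ℤ → ℕ∞ → Set
ν₂≥ x (just k) = (+ (2 ^ k)) ∣ x
ν₂≥ x nothing  = x ≡ 0ℤ

M : ℕ → ℕ → ℕ∞
M zero zero = just 3
M zero (suc zero) = just 7
M zero (suc (suc zero)) = just 11
M zero (suc (suc (suc zero))) = just 11
M zero (suc (suc (suc (suc _)))) = ∞
M (suc zero) zero = just 1
M (suc (suc zero)) zero = just 0
M (suc (suc (suc zero))) zero = just 0
M (suc (suc (suc (suc _)))) zero = ∞
M (suc a) (suc b) =
  if (a ≤ᵇ b) then (if (b ∸ a ≤ᵇ 3) then just 1 else ∞)
  else (if (a ∸ b ≤ᵇ 3) then just 0 else ∞)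

-- P is tridiagonal, so E r s = 0 once |r - s| > 48, in particular whenever r and s lie in
-- intervals three or more apart; this gives every bound ∞.  Modulo 2, P (r + 2) (s + 2) ≡ P r s
-- and P 1 2 = -2 ≡ 0, so P mod 2 is block lower triangular with lower right block again P; hence
-- E (r + 2) (s + 2) ≡ E r s (mod 2), which reduces the evenness of E for r < s + 24 (covering
-- I_a × I_b for 1 ≤ a ≤ b) to its first two rows and columns.  Those, and the finite blocks
-- I_0 × I_b and I_1 × I_0, are checked by computing rows of P⁴⁸ exactly.
module Submission where

open import Data.Bool using (true; false; if_then_else_)
open import Data.Fin using (Fin; toℕ; fromℕ<)
open import Data.Fin.Properties using (all?; toℕ-fromℕ<)
open import Data.Integer as ℤ using (ℤ; +_; 0ℤ; 1ℤ; _-_; -_)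
open import Data.Integer.Divisibility using (_∣_)
import Data.Integer.Divisibility.Signed as Signed
import Data.Integer.Properties as ℤ
open import Data.Integer.Tactic.RingSolver using (solve-∀)
open import Data.List using (List; []; _∷_)
open import Data.Maybe using (just; nothing)
open import Data.Nat as ℕ using (ℕ; zero; suc; _^_; _≤_; _<_; _≤ᵇ_; _∸_; z≤n; s≤s; s≤s⁻¹)
import Data.Nat.Divisibility as ℕ
import Data.Nat.Properties as ℕ
import Data.Nat.Tactic.RingSolver as ℕ-Solver
open import Data.Product using (_,_)
open import Data.Sum using ([_,_]′)
open import Data.Unit using (tt)
open import Relation.Binary.PropositionalEquality
open import Function using (_∘_)
open import Relation.Nullary using (Dec; ofʸ; ofⁿ)
open import Relation.Nullary.Reflects using (Reflects)
import Relation.Nullary.Decidable as Dec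
open import Relation.Nullary.Decidable using (True; toWitness; dec-false)

open import Defs

infix 4 _≡_mod_
record _≡_mod_ (x y m : ℤ) : Set where
  constructor ≡-mod
  field divides-difference : m Signed.∣ x - y

≡⇒≡-mod : ∀ {x y m} → x ≡ y → x ≡ y mod m
≡⇒≡-mod {x} refl = ≡-mod (Signed.divides 0ℤ (ℤ.+-inverseʳ x))

≡-mod-trans : ∀ {x y z m} → x ≡ y mod m → y ≡ z mod m → x ≡ z mod m
≡-mod-trans {x} {y} {z} (≡-mod p) (≡-mod q) =
  ≡-mod (subst (_ Signed.∣_) (telescope x y z) (Signed.∣m∣n⇒∣m+n p q))
  where telescope : ∀ x y z → (x - y) ℤ.+ (y - z) ≡ x - z
        telescope = solve-∀

+-cong-mod : ∀ {x x′ y y′ m} → x ≡ x′ mod m → y ≡ y′ mod m → x ℤ.+ y ≡ x′ ℤ.+ y′ mod m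
+-cong-mod {x} {x′} {y} {y′} (≡-mod p) (≡-mod q) =
  ≡-mod (subst (_ Signed.∣_) (regroup x x′ y y′) (Signed.∣m∣n⇒∣m+n p q))
  where regroup : ∀ x x′ y y′ → (x - x′) ℤ.+ (y - y′) ≡ (x ℤ.+ y) - (x′ ℤ.+ y′)
        regroup = solve-∀

*-cong-mod : ∀ {x x′ y y′ m} → x ≡ x′ mod m → y ≡ y′ mod m → x ℤ.* y ≡ x′ ℤ.* y′ mod m
*-cong-mod {x} {x′} {y} {y′} (≡-mod p) (≡-mod q) =
  ≡-mod (subst (_ Signed.∣_) (regroup x x′ y y′) (Signed.∣m∣n⇒∣m+n (Signed.∣m⇒∣m*n y p) (Signed.∣n⇒∣m*n x′ q)))
  where regroup : ∀ x x′ y y′ → (x - x′) ℤ.* y ℤ.+ x′ ℤ.* (y - y′) ≡ x ℤ.* y - x′ ℤ.* y′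
        regroup = solve-∀

∣-resp-≡-mod : ∀ {x y k} → x ≡ y mod + k → + k ∣ y → + k ∣ x
∣-resp-≡-mod {x} {y} {k} (≡-mod p) k∣y =
  Signed.∣⇒∣ᵤ (Signed.∣m+n∣n⇒∣m {m = x} p (Signed.∣m⇒∣-m (Signed.∣ᵤ⇒∣ {+ k} {y} k∣y)))

I-off-diagonal : ∀ {r s} → r ≢ s → I r s ≡ 0ℤ
I-off-diagonal {r} {s} r≢s rewrite dec-false (r ℕ.≟ s) r≢s = refl

P-off-band : ∀ {t s} → t ≢ s → s ≢ suc t → t ≢ suc s → P t s ≡ 0ℤ
P-off-band {t} {s} t≢s s≢1+t t≢1+s
  rewrite dec-false (t ℕ.≟ s) t≢s | dec-false (s ℕ.≟ suc t) s≢1+t | dec-false (t ℕ.≟ suc s) t≢1+s = refl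

P-above-band : ∀ {t s} → t < s → P t (suc s) ≡ 0ℤ
P-above-band t<s = P-off-band (ℕ.<⇒≢ (ℕ.m<n⇒m<1+n t<s)) (ℕ.<⇒≢ (s≤s t<s) ∘ sym) (ℕ.<⇒≢ (ℕ.m<n⇒m<1+n (ℕ.m<n⇒m<1+n t<s)))

bandColumn : ℕ → ℤ → ℤ → ℤ → ℤ
bandColumn s x y z = x ℤ.* P s (suc s) ℤ.+ y ℤ.* P (suc s) (suc s) ℤ.+ z ℤ.* P (suc (suc s)) (suc s)

column : (ℕ → ℤ) → ℕ → ℤ
column v zero    = v 0 ℤ.* P 0 0 ℤ.+ v 1 ℤ.* P 1 0
column v (suc s) = bandColumn s (v s) (v (suc s)) (v (suc (suc s)))

column-vanishes : ∀ v s → v s ≡ 0ℤ → v (suc s) ≡ 0ℤ → v (suc (suc s)) ≡ 0ℤ → column v (suc s) ≡ 0ℤ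
column-vanishes v s v₀ v₁ v₂
  rewrite v₀ | v₁ | v₂ | ℤ.*-zeroˡ (P s (suc s)) | ℤ.*-zeroˡ (P (suc s) (suc s)) | ℤ.*-zeroˡ (P (suc (suc s)) (suc s)) = refl

column-cong : ∀ {v w} → (∀ t → v t ≡ w t) → ∀ s → column v s ≡ column w s
column-cong v≗w zero    rewrite v≗w 0 | v≗w 1 = refl
column-cong v≗w (suc s) rewrite v≗w s | v≗w (suc s) | v≗w (suc (suc s)) = refl

sumTo-vanishing : ∀ n f → (∀ t → t < n → f t ≡ 0ℤ) → sumTo n f ≡ 0ℤ
sumTo-vanishing zero    f f≡0 = refl
sumTo-vanishing (suc n) f f≡0
  rewrite sumTo-vanishing n f (λ t t<n → f≡0 t (ℕ.m<n⇒m<1+n t<n)) | f≡0 n ℕ.≤-refl = refl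

sumTo-*P≡column : ∀ v s → sumTo (suc (suc s)) (λ t → v t ℤ.* P t s) ≡ column v s
sumTo-*P≡column v zero = cong (ℤ._+ v 1 ℤ.* P 1 0) (ℤ.+-identityˡ (v 0 ℤ.* P 0 0))
sumTo-*P≡column v (suc s) = begin
  sumTo s f ℤ.+ f s ℤ.+ f (suc s) ℤ.+ f (suc (suc s))
    ≡⟨ cong (λ z → z ℤ.+ f s ℤ.+ f (suc s) ℤ.+ f (suc (suc s))) (sumTo-vanishing s f f-vanishes) ⟩
  0ℤ ℤ.+ f s ℤ.+ f (suc s) ℤ.+ f (suc (suc s))
    ≡⟨ cong (λ z → z ℤ.+ f (suc s) ℤ.+ f (suc (suc s))) (ℤ.+-identityˡ (f s)) ⟩
  column v (suc s) ∎
  where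
    open ≡-Reasoning
    f : ℕ → ℤ
    f t = v t ℤ.* P t (suc s)
    f-vanishes : ∀ t → t < s → f t ≡ 0ℤ
    f-vanishes t t<s = trans (cong (v t ℤ.*_) (P-above-band t<s)) (ℤ.*-zeroʳ (v t))

Ppow-suc : ∀ n r s → Ppow (suc n) r s ≡ column (Ppow n r) s
Ppow-suc n r = sumTo-*P≡column (Ppow n r)

Ppow-above : ∀ n {r s} → r ℕ.+ n < s → Ppow n r s ≡ 0ℤ
Ppow-above zero {r} r+0<s = I-off-diagonal (ℕ.<⇒≢ (subst (_< _) (ℕ.+-identityʳ r) r+0<s))
Ppow-above (suc n) {r} {suc s} r+1+n<1+s =
  trans (Ppow-suc n r (suc s))
        (column-vanishes (Ppow n r) s (Ppow-above n r+n<s)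
                                      (Ppow-above n (ℕ.m<n⇒m<1+n r+n<s))
                                      (Ppow-above n (ℕ.m<n⇒m<1+n (ℕ.m<n⇒m<1+n r+n<s))))
  where r+n<s : r ℕ.+ n < s
        r+n<s = s≤s⁻¹ (subst (_< suc s) (ℕ.+-suc r n) r+1+n<1+s)

Ppow-below : ∀ n {r s} → s ℕ.+ n < r → Ppow n r s ≡ 0ℤ
Ppow-below zero {r} {s} s+0<r = I-off-diagonal (ℕ.<⇒≢ (subst (_< r) (ℕ.+-identityʳ s) s+0<r) ∘ sym)
Ppow-below (suc n) {r} {zero} 1+n<r
  rewrite Ppow-suc n r zero
        | Ppow-below n {r} {0} (ℕ.<-trans (ℕ.n<1+n n) 1+n<r)
        | Ppow-below n {r} {1} 1+n<r = refl
Ppow-below (suc n) {r} {suc s} s+1+n<r =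
  trans (Ppow-suc n r (suc s))
        (column-vanishes (Ppow n r) s (Ppow-below n (ℕ.<-trans (ℕ.n<1+n _) (ℕ.<-trans (ℕ.n<1+n _) 2+s+n<r)))
                                      (Ppow-below n (ℕ.<-trans (ℕ.n<1+n _) 2+s+n<r))
                                      (Ppow-below n 2+s+n<r))
  where 2+s+n<r : suc (suc s ℕ.+ n) < r
        2+s+n<r = subst (_< r) (cong suc (ℕ.+-suc s n)) s+1+n<r

E-above : ∀ r s → r ℕ.+ 48 < s → E r s ≡ 0ℤ
E-above r s r+48<s = cong₂ _-_ (Ppow-above 48 r+48<s) (I-off-diagonal (ℕ.<⇒≢ (ℕ.≤-<-trans (ℕ.m≤m+n r 48) r+48<s)))

E-below : ∀ r s → s ℕ.+ 48 < r → E r s ≡ 0ℤ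
E-below r s s+48<r = cong₂ _-_ (Ppow-below 48 s+48<r) (I-off-diagonal (ℕ.<⇒≢ (ℕ.≤-<-trans (ℕ.m≤m+n s 48) s+48<r) ∘ sym))

P-shift : ∀ r s → P (suc (suc r)) (suc (suc s)) ≡ P r s mod + 2
P-shift r s with r ℕ.≡ᵇ s
... | true  = ≡-mod (Signed.divides 1ℤ (diagonal (+ r)))
  where diagonal : ∀ x → (+ 2 ℤ.+ x) - 1ℤ - (x - 1ℤ) ≡ 1ℤ ℤ.* + 2
        diagonal = solve-∀
... | false with s ℕ.≡ᵇ suc r
...   | true  = ≡-mod (Signed.divides (- 1ℤ) (superdiagonal (+ r)))
  where superdiagonal : ∀ x → - (+ 2 ℤ.+ x) - 1ℤ - (- x - 1ℤ) ≡ - 1ℤ ℤ.* + 2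
        superdiagonal = solve-∀
...   | false with r ℕ.≡ᵇ suc s
...     | true  = ≡⇒≡-mod refl
...     | false = ≡⇒≡-mod refl

-- At s = 0 the extra term u 1 * P 1 2 of column 2 vanishes since P 1 2 = -2.
column-shift : ∀ u v → (∀ t → u (suc (suc t)) ≡ v t mod + 2) → ∀ s → column u (suc (suc s)) ≡ column v s mod + 2
column-shift u v u≡v zero =
  +-cong-mod (≡-mod-trans (+-cong-mod u₁P₁₂≡0 (*-cong-mod (u≡v 0) (P-shift 0 0))) (≡⇒≡-mod (ℤ.+-identityˡ (v 0 ℤ.* P 0 0))))
             (*-cong-mod (u≡v 1) (P-shift 1 0))
  where u₁P₁₂≡0 : u 1 ℤ.* P 1 2 ≡ 0ℤ mod + 2
        u₁P₁₂≡0 = ≡-mod (Signed.divides (- u 1) (times-minus-two (u 1)))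
          where times-minus-two : ∀ x → x ℤ.* - + 2 - 0ℤ ≡ - x ℤ.* + 2
                times-minus-two = solve-∀
column-shift u v u≡v (suc s) =
  +-cong-mod (+-cong-mod (*-cong-mod (u≡v s) (P-shift s (suc s)))
                         (*-cong-mod (u≡v (suc s)) (P-shift (suc s) (suc s))))
             (*-cong-mod (u≡v (suc (suc s))) (P-shift (suc (suc s)) (suc s)))

Ppow-shift : ∀ n r s → Ppow n (suc (suc r)) (suc (suc s)) ≡ Ppow n r s mod + 2
Ppow-shift zero    r s = ≡⇒≡-mod refl
Ppow-shift (suc n) r s
  rewrite Ppow-suc n (suc (suc r)) (suc (suc s)) | Ppow-suc n r s = column-shift (Ppow n (suc (suc r))) (Ppow n r) (Ppow-shift n r) s

E-shift : ∀ r s → E (suc (suc r)) (suc (suc s)) ≡ E r s mod + 2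
E-shift r s = +-cong-mod (Ppow-shift 48 r s) (≡⇒≡-mod refl)

at : List ℤ → ℕ → ℤ
at []       _       = 0ℤ
at (x ∷ _)  zero    = x
at (_ ∷ xs) (suc t) = at xs t

bandColumns : ℕ → List ℤ → List ℤ
bandColumns s []       = []
bandColumns s (x ∷ xs) = bandColumn s x (at xs 0) (at xs 1) ∷ bandColumns (suc s) xs

at-bandColumns : ∀ s xs i → at (bandColumns s xs) i ≡ bandColumn (i ℕ.+ s) (at xs i) (at xs (suc i)) (at xs (suc (suc i)))
at-bandColumns s []       i       = sym (column-vanishes (λ _ → 0ℤ) (i ℕ.+ s) refl refl refl)
at-bandColumns s (x ∷ xs) zero    = refl
at-bandColumns s (x ∷ xs) (suc i) rewrite at-bandColumns (suc s) xs i | ℕ.+-suc i s = refl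

timesP : List ℤ → List ℤ
timesP xs = column (at xs) 0 ∷ bandColumns 0 xs

at-timesP : ∀ xs s → at (timesP xs) s ≡ column (at xs) s
at-timesP xs zero    = refl
at-timesP xs (suc s) =
  trans (at-bandColumns 0 xs s)
        (cong (λ k → bandColumn k (at xs s) (at xs (suc s)) (at xs (suc (suc s)))) (ℕ.+-identityʳ s))

unitRow : ℕ → List ℤ
unitRow zero    = 1ℤ ∷ []
unitRow (suc r) = 0ℤ ∷ unitRow r

at-unitRow : ∀ r s → at (unitRow r) s ≡ I r s
at-unitRow zero    zero    = refl
at-unitRow zero    (suc s) = refl
at-unitRow (suc r) zero    = refl
at-unitRow (suc r) (suc s) = at-unitRow r s

powerRow : ℕ → ℕ → List ℤ
powerRow zero    r = unitRow r
powerRow (suc n) r = timesP (powerRow n r)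

at-powerRow : ∀ n r s → at (powerRow n r) s ≡ Ppow n r s
at-powerRow zero    r s = at-unitRow r s
at-powerRow (suc n) r s = begin
  at (timesP (powerRow n r)) s   ≡⟨ at-timesP (powerRow n r) s ⟩
  column (at (powerRow n r)) s   ≡⟨ column-cong (at-powerRow n r) s ⟩
  column (Ppow n r) s            ≡⟨ Ppow-suc n r s ⟨
  Ppow (suc n) r s               ∎
  where open ≡-Reasoning

BlockDivisible : ℕ → ℕ → ℕ → ℕ → ℕ → Set
BlockDivisible k r₀ h s₀ w = ∀ (i : Fin h) (j : Fin w) → + k ∣ E (r₀ ℕ.+ toℕ i) (s₀ ℕ.+ toℕ j)

-- Passing the row as an argument of rowDivisible? shares its computation among its entries.
blockDivisible? : ∀ k r₀ h s₀ w → Dec (BlockDivisible k r₀ h s₀ w)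
blockDivisible? k r₀ h s₀ w =
  all? {P = λ i → RowDivisible (r₀ ℕ.+ toℕ i)} λ i →
    rowDivisible? (r₀ ℕ.+ toℕ i) (powerRow 48 (r₀ ℕ.+ toℕ i)) (at-powerRow 48 (r₀ ℕ.+ toℕ i))
  where
    RowDivisible : ℕ → Set
    RowDivisible r = ∀ (j : Fin w) → + k ∣ E r (s₀ ℕ.+ toℕ j)

    rowDivisible? : ∀ r xs → (∀ s → at xs s ≡ Ppow 48 r s) → Dec (RowDivisible r)
    rowDivisible? r xs xs≗row = all? {P = λ j → + k ∣ E r (s₀ ℕ.+ toℕ j)} λ j →
      Dec.map′ (subst (+ k ∣_) (entry (s₀ ℕ.+ toℕ j))) (subst (+ k ∣_) (sym (entry (s₀ ℕ.+ toℕ j))))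
               (k ℕ.∣? ℤ.∣ at xs (s₀ ℕ.+ toℕ j) - I r (s₀ ℕ.+ toℕ j) ∣)
      where entry : ∀ s → at xs s - I r s ≡ E r s
            entry s = cong (_- I r s) (xs≗row s)

∀Fin-offset⇒range : ∀ {P : ℕ → Set} {m h n} → (∀ (i : Fin h) → P (m ℕ.+ toℕ i)) → m ≤ n → n < m ℕ.+ h → P n
∀Fin-offset⇒range {P} {m} {h} {n} P-offsets m≤n n<m+h = subst P m+i≡n (P-offsets (fromℕ< n∸m<h))
  where
    n∸m<h : n ∸ m < h
    n∸m<h = ℕ.+-cancelˡ-< m (n ∸ m) h (subst (_< m ℕ.+ h) (sym (ℕ.m+[n∸m]≡n m≤n)) n<m+h)
    m+i≡n : m ℕ.+ toℕ (fromℕ< n∸m<h) ≡ n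
    m+i≡n = trans (cong (m ℕ.+_) (toℕ-fromℕ< n∸m<h)) (ℕ.m+[n∸m]≡n m≤n)

E-block-∣ : ∀ k r₀ h s₀ w → True (blockDivisible? k r₀ h s₀ w) →
            ∀ r s → r₀ ≤ r → r < r₀ ℕ.+ h → s₀ ≤ s → s < s₀ ℕ.+ w → + k ∣ E r s
E-block-∣ k r₀ h s₀ w decided r s r₀≤r r<r₀+h = ∀Fin-offset⇒range {P = λ s → + k ∣ E r s} {s₀} {w} row
  where
    row : ∀ (j : Fin w) → + k ∣ E r (s₀ ℕ.+ toℕ j)
    row j = ∀Fin-offset⇒range {P = λ r → + k ∣ E r (s₀ ℕ.+ toℕ j)} {r₀} {h}
              (λ i → toWitness decided i j) r₀≤r r<r₀+h

E-divisible-I₀×I₀ : ∀ r s → InInterval 0 r → InInterval 0 s → ν₂≥ (E r s) (M 0 0)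
E-divisible-I₀×I₀ r s r<8 s<8 = E-block-∣ (2 ^ 3) 0 8 0 8 tt r s z≤n r<8 z≤n s<8

E-divisible-I₀×I₁ : ∀ r s → InInterval 0 r → InInterval 1 s → ν₂≥ (E r s) (M 0 1)
E-divisible-I₀×I₁ r s r<8 (8≤s , s<32) = E-block-∣ (2 ^ 7) 0 8 8 24 tt r s z≤n r<8 8≤s s<32

E-divisible-I₀×I₂ : ∀ r s → InInterval 0 r → InInterval 2 s → ν₂≥ (E r s) (M 0 2)
E-divisible-I₀×I₂ r s r<8 (32≤s , s<56) = E-block-∣ (2 ^ 11) 0 8 32 24 tt r s z≤n r<8 32≤s s<56

E-divisible-I₁×I₀ : ∀ r s → InInterval 1 r → InInterval 0 s → ν₂≥ (E r s) (M 1 0)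
E-divisible-I₁×I₀ r s (8≤r , r<32) s<8 = E-block-∣ 2 8 24 0 8 tt r s 8≤r r<32 z≤n s<8

E-even-first-columns : ∀ r s → r < 26 → s < 2 → + 2 ∣ E r s
E-even-first-columns r s r<26 s<2 = E-block-∣ 2 0 26 0 2 tt r s z≤n r<26 z≤n s<2

zero⇒ν₂≥ : ∀ x → x ≡ 0ℤ → ∀ m → ν₂≥ x m
zero⇒ν₂≥ _ refl (just k) = (2 ^ k) ℕ.∣0
zero⇒ν₂≥ _ refl nothing  = refl

E-even-first-rows : ∀ r s → r < 2 → + 2 ∣ E r s
E-even-first-rows r s r<2 = [ E-even-near , E-even-far ]′ (ℕ.<-≤-connex s 50)
  where
    E-even-near : s < 50 → + 2 ∣ E r s
    E-even-near s<50 = E-block-∣ 2 0 2 0 50 tt r s z≤n r<2 z≤n s<50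

    E-even-far : 50 ≤ s → + 2 ∣ E r s
    E-even-far 50≤s = zero⇒ν₂≥ (E r s) (E-above r s (ℕ.<-≤-trans (ℕ.+-monoˡ-< 48 r<2) 50≤s)) (just 1)

-- Shifting by 2 reduces every entry with r < 24 + s to the first two rows or columns.
E-even : ∀ r s → r < 24 ℕ.+ s → + 2 ∣ E r s
E-even zero          s             _ = E-even-first-rows zero s (s≤s z≤n)
E-even (suc zero)    s             _ = E-even-first-rows (suc zero) s (s≤s (s≤s z≤n))
E-even (suc (suc r)) zero          r<24 =
  E-even-first-columns (suc (suc r)) zero (ℕ.m<n⇒m<1+n (ℕ.m<n⇒m<1+n r<24)) (s≤s z≤n)
E-even (suc (suc r)) (suc zero)    r<25 =
  E-even-first-columns (suc (suc r)) (suc zero) (ℕ.m<n⇒m<1+n r<25) (s≤s (s≤s z≤n))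
E-even (suc (suc r)) (suc (suc s)) r<24+s =
  ∣-resp-≡-mod {E (suc (suc r)) (suc (suc s))} {E r s} (E-shift r s) (E-even r s (s≤s⁻¹ (s≤s⁻¹ r<24+s)))

lowerEnd : ℕ → ℕ
lowerEnd zero    = 0
lowerEnd (suc k) = 8 ℕ.+ 24 ℕ.* k

InInterval⇒lowerEnd≤ : ∀ {a r} → InInterval a r → lowerEnd a ≤ r
InInterval⇒lowerEnd≤ {zero}  _         = z≤n
InInterval⇒lowerEnd≤ {suc a} (lo , _)  = lo

InInterval⇒<lowerEnd : ∀ {a r} → InInterval a r → r < lowerEnd (suc a)
InInterval⇒<lowerEnd {zero}  r<8      = r<8
InInterval⇒<lowerEnd {suc a} (_ , hi) = hi

lowerEnd-mono : ∀ {a b} → a ≤ b → lowerEnd a ≤ lowerEnd b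
lowerEnd-mono {zero}          _   = z≤n
lowerEnd-mono {suc a} {suc b} a≤b = ℕ.+-monoʳ-≤ 8 (ℕ.*-monoʳ-≤ 24 (s≤s⁻¹ a≤b))

lowerEnd-next : ∀ a → lowerEnd (suc (suc a)) ≡ 24 ℕ.+ lowerEnd (suc a)
lowerEnd-next a = next a
  where next : ∀ a → 8 ℕ.+ 24 ℕ.* suc a ≡ 24 ℕ.+ (8 ℕ.+ 24 ℕ.* a)
        next = ℕ-Solver.solve-∀

lowerEnd-gap : ∀ a → lowerEnd (suc a) ℕ.+ 48 ≡ lowerEnd (3 ℕ.+ a)
lowerEnd-gap zero    = refl
lowerEnd-gap (suc a) = gap a
  where gap : ∀ a → 8 ℕ.+ 24 ℕ.* suc a ℕ.+ 48 ≡ 8 ℕ.+ 24 ℕ.* suc (suc (suc a))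
        gap = ℕ-Solver.solve-∀

intervals-far-apart : ∀ a b {r s} → InInterval a r → InInterval b s → 3 ℕ.+ a ≤ b → r ℕ.+ 48 < s
intervals-far-apart a b {r} {s} r∈Iₐ s∈I_b 3+a≤b = begin-strict
  r ℕ.+ 48                 <⟨ ℕ.+-monoˡ-< 48 (InInterval⇒<lowerEnd {a} r∈Iₐ) ⟩
  lowerEnd (suc a) ℕ.+ 48  ≡⟨ lowerEnd-gap a ⟩
  lowerEnd (3 ℕ.+ a)       ≤⟨ lowerEnd-mono 3+a≤b ⟩
  lowerEnd b               ≤⟨ InInterval⇒lowerEnd≤ {b} s∈I_b ⟩
  s                        ∎
  where open ℕ.≤-Reasoning

intervals-near : ∀ a b {r s} → InInterval (suc a) r → InInterval (suc b) s → a ≤ b → r < 24 ℕ.+ s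
intervals-near a b {r} {s} r∈Iₐ s∈I_b a≤b = begin-strict
  r                        <⟨ InInterval⇒<lowerEnd {suc a} r∈Iₐ ⟩
  lowerEnd (suc (suc a))   ≡⟨ lowerEnd-next a ⟩
  24 ℕ.+ lowerEnd (suc a)  ≤⟨ ℕ.+-monoʳ-≤ 24 (lowerEnd-mono (s≤s a≤b)) ⟩
  24 ℕ.+ lowerEnd (suc b)  ≤⟨ ℕ.+-monoʳ-≤ 24 (InInterval⇒lowerEnd≤ {suc b} s∈I_b) ⟩
  24 ℕ.+ s                 ∎
  where open ℕ.≤-Reasoning

-- M (suc a) (suc b) only reduces to this once a is split into the cases 0, 1, 2, 3 + a.
M-later : ℕ → ℕ → ℕ∞
M-later a b = if a ≤ᵇ b then (if b ∸ a ≤ᵇ 3 then just 1 else ∞) else (if a ∸ b ≤ᵇ 3 then just 0 else ∞)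

M-suc-suc : ∀ a b → M (suc a) (suc b) ≡ M-later a b
M-suc-suc zero                b = refl
M-suc-suc (suc zero)          b = refl
M-suc-suc (suc (suc zero))    b = refl
M-suc-suc (suc (suc (suc a))) b = refl

E-bound-later-intervals : ∀ a b r s → InInterval (suc a) r → InInterval (suc b) s → ν₂≥ (E r s) (M-later a b)
E-bound-later-intervals a b r s r∈Iₐ s∈I_b = by-order (a ≤ᵇ b) (ℕ.≤ᵇ-reflects-≤ a b)
  where
    above-diagonal : a ≤ b → ∀ c → Reflects (b ∸ a ≤ 3) c → ν₂≥ (E r s) (if c then just 1 else ∞)
    above-diagonal a≤b true  _           = E-even r s (intervals-near a b r∈Iₐ s∈I_b a≤b)
    above-diagonal a≤b false (ofⁿ b∸a≰3) =
      zero⇒ν₂≥ (E r s) (E-above r s (intervals-far-apart (suc a) (suc b) r∈Iₐ s∈I_b 3+a≤b)) ∞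
      where 3+a≤b : 3 ℕ.+ suc a ≤ suc b
            3+a≤b = s≤s (ℕ.m≤o∸n⇒m+n≤o 3 a≤b (ℕ.<⇒≤ (ℕ.≰⇒> b∸a≰3)))

    below-diagonal : b ≤ a → ∀ c → Reflects (a ∸ b ≤ 3) c → ν₂≥ (E r s) (if c then just 0 else ∞)
    below-diagonal b≤a true  _           = ℕ.1∣ ℤ.∣ E r s ∣
    below-diagonal b≤a false (ofⁿ a∸b≰3) =
      zero⇒ν₂≥ (E r s) (E-below r s (intervals-far-apart (suc b) (suc a) s∈I_b r∈Iₐ 3+b≤a)) ∞
      where 3+b≤a : 3 ℕ.+ suc b ≤ suc a
            3+b≤a = s≤s (ℕ.m≤o∸n⇒m+n≤o 3 b≤a (ℕ.<⇒≤ (ℕ.≰⇒> a∸b≰3)))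

    by-order : ∀ c → Reflects (a ≤ b) c →
               ν₂≥ (E r s) (if c then (if b ∸ a ≤ᵇ 3 then just 1 else ∞)
                                 else (if a ∸ b ≤ᵇ 3 then just 0 else ∞))
    by-order true  (ofʸ a≤b) = above-diagonal a≤b (b ∸ a ≤ᵇ 3) (ℕ.≤ᵇ-reflects-≤ (b ∸ a) 3)
    by-order false (ofⁿ a≰b) = below-diagonal (ℕ.<⇒≤ (ℕ.≰⇒> a≰b)) (a ∸ b ≤ᵇ 3) (ℕ.≤ᵇ-reflects-≤ (a ∸ b) 3)

proposition5p5 : (a b r s : ℕ) → InInterval a r → InInterval b s → ν₂≥ (E r s) (M a b)
proposition5p5 0 0 r s r∈I₀ s∈I₀ = E-divisible-I₀×I₀ r s r∈I₀ s∈I₀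
proposition5p5 0 1 r s r∈I₀ s∈I₁ = E-divisible-I₀×I₁ r s r∈I₀ s∈I₁
proposition5p5 0 2 r s r∈I₀ s∈I₂ = E-divisible-I₀×I₂ r s r∈I₀ s∈I₂
proposition5p5 0 (suc (suc (suc b))) r s r∈I₀ s∈I_b =
  zero⇒ν₂≥ (E r s) (E-above r s (intervals-far-apart 0 (3 ℕ.+ b) r∈I₀ s∈I_b (ℕ.m≤m+n 3 b))) (M 0 (3 ℕ.+ b))
proposition5p5 1 0 r s r∈I₁ s∈I₀ = E-divisible-I₁×I₀ r s r∈I₁ s∈I₀
proposition5p5 2 0 r s _ _ = ℕ.1∣ ℤ.∣ E r s ∣
proposition5p5 (suc (suc (suc a))) 0 r s r∈Iₐ s∈I₀ =
  zero⇒ν₂≥ (E r s) (E-below r s (intervals-far-apart 0 (3 ℕ.+ a) s∈I₀ r∈Iₐ (ℕ.m≤m+n 3 a))) (M (3 ℕ.+ a) 0)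
proposition5p5 (suc a) (suc b) r s r∈Iₐ s∈I_b =
  subst (ν₂≥ (E r s)) (sym (M-suc-suc a b)) (E-bound-later-intervals a b r s r∈Iₐ s∈I_b)
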